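{- Let $n \geq 2$ and let $D=(d_1,\dots,d_n) \in [m]^n$ be a demand profile. Then \[ p_{\textsc{Cluster}}(D) = \Theta\Big(\min\Big(1, \frac{n\|D\|_1}{m}\Big)\Big). \]
   Context: Fix $m\in\mathbb N$ and the universe of IDs $[m]=\{1,\dots,m\}$. An ID-generation algorithm $\mathcal A$ is a probability distribution over permutations of $[m]$: an instance of $\mathcal A$ draws a permutation and answers its $t$-th request with the $t$-th entry. A demand profile $D=(d_1,\dots,d_n)\in[m]^n$ means that $n$ instances of $\mathcal A$ with independent randomness are run and instance $i$ receives $d_i$ requests (one at a time, without knowing $d_i$ in advance). A collision occurs if the sets of IDs output by the $n$ instances are not pairwise disjoint; $p_{\mathcal A}(D)$ denotes the probability of a collision. $\|D\|_1=\sum_i d_i$. Algorithm Cluster: pick $x\in[m]$ uniformly at random and return IDs in the order $x, x+1, x+2,\dots$, all taken modulo $m$ (within $[m]$). Asymptotic notation is non-asymptotic: $f=O(g)$ means there is an absolute constant $c>0$, independent of all parameters (including $m$, $n$, $D$), with $f\le c\, g$ for all parameter values; $\Omega$ is the reverse inequality and $\Theta$ means both. -}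

module Defs where

open import Data.Nat using (ℕ; zero; suc; _+_; _*_; _^_; _≡ᵇ_; _<ᵇ_; NonZero)
open import Data.Nat.DivMod using (_%_)
open import Data.Nat.Properties using (m^n≢0)
open import Data.Bool using (Bool; true; false; _∧_; not)
open import Data.Fin using (Fin; toℕ)
open import Data.List using (List; []; _∷_; [_]; map; concatMap; upTo; length; filterᵇ; allFin)
open import Data.Bool.ListAction using (any)
open import Data.Vec using (Vec; lookup) renaming ([] to []ᵥ; _∷_ to _∷ᵥ_)
open import Data.Vec using () renaming (sum to vsum)
open import Data.Integer using (+_)
open import Data.Rational using (ℚ; _/_; 1ℚ; _⊓_)
open import Relation.Nullary.Decidable using (⌊_⌋)

-- IDs are represented as 0,…,m-1 (the ID j+1 ∈ [m] is represented by j).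

-- All possible random choices of the n Cluster instances: a starting point
-- x_i ∈ {0,…,m-1} for each instance (uniform, independent).
allStarts : (m n : ℕ) → List (Vec ℕ n)
allStarts m zero    = [ []ᵥ ]
allStarts m (suc n) = concatMap (λ x → map (x ∷ᵥ_) (allStarts m n)) (upTo m)

clusterOutputs : (m : ℕ) .{{_ : NonZero m}} → (x d : ℕ) → List ℕ
clusterOutputs m x d = map (λ k → (x + k) % m) (upTo d)

intersects : List ℕ → List ℕ → Bool
intersects l₁ l₂ = any (λ a → any (λ b → a ≡ᵇ b) l₂) l₁

collision : (m : ℕ) .{{_ : NonZero m}} → {n : ℕ} → (D x : Vec ℕ n) → Bool
collision m {n} D x =
  any (λ i → any (λ j → (toℕ i <ᵇ toℕ j) ∧
         intersects (clusterOutputs m (lookup x i) (lookup D i))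
                    (clusterOutputs m (lookup x j) (lookup D j)))
       (allFin n))
      (allFin n)

collisionCount : (m : ℕ) .{{_ : NonZero m}} → {n : ℕ} → Vec ℕ n → ℕ
collisionCount m {n} D = length (filterᵇ (λ x → collision m D x) (allStarts m n))

pCluster : (m : ℕ) .{{_ : NonZero m}} → {n : ℕ} → Vec ℕ n → ℚ
pCluster m {n} D = (+ collisionCount m D) / (m ^ n)
  where instance _ = m^n≢0 m n

clusterBound : (m : ℕ) .{{_ : NonZero m}} → {n : ℕ} → Vec ℕ n → ℚ
clusterBound m {n} D = 1ℚ ⊓ ((+ (n * vsum D)) / m)

{-# OPTIONS --safe #-}
module Submission where

-- Upper bound: an instance with demand d meets a fixed arc of length e for at most d + e of
-- its m possible starts, so by the union bound over pairs of instances at most a fraction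
-- n‖D‖₁/m of the start vectors collide.
-- Lower bound: split the instances into two groups of sizes k, l ≥ n/3 and let the first carry
-- the larger total demand S ≥ ‖D‖₁/2. Without a collision the first group covers S distinct
-- IDs, and since every instance outputs its own start, each of the l starts of the second
-- group avoids them; hence P(no collision) ≤ (1 − S/m)^l. Bernoulli's inequality
-- (1 − S/m)^l (1 + lS/m) ≤ 1 turns this into P(collision) ≥ X/(m + X) with X = lS ≥ n‖D‖₁/6,
-- which is at least min(1, n‖D‖₁/m)/12.

open import Data.Nat using (ℕ; _≤_; NonZero)
open import Data.Vec using (Vec)

module Arithmetic where

  open import Data.Nat using (zero; suc; _+_; _*_; _∸_; _^_; _≤_; z≤n; s≤s)
  open import Data.Nat.Properties
  open import Data.Nat.Tactic.RingSolver using (solve-∀)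
  open import Algebra.Properties.CommutativeSemigroup *-commutativeSemigroup using (x∙yz≈y∙xz)
  open import Data.Product using (∃₂; _×_; _,_)
  open import Relation.Binary.PropositionalEquality
  open import Relation.Nullary using (yes; no)

  bernoulli : ∀ t s b → t ^ b * (t + s + b * s) ≤ (t + s) ^ b * (t + s)
  bernoulli t s zero = ≤-reflexive (cong (1 *_) (+-identityʳ (t + s)))
  bernoulli t s (suc b) = begin
    t ^ suc b * (t + s + suc b * s)        ≡⟨ *-assoc t (t ^ b) _ ⟩
    t * (t ^ b * (t + s + suc b * s))      ≡⟨ x∙yz≈y∙xz t (t ^ b) _ ⟩
    t ^ b * (t * (t + s + suc b * s))      ≤⟨ *-monoʳ-≤ (t ^ b) step ⟩
    t ^ b * ((t + s) * (t + s + b * s))    ≡⟨ x∙yz≈y∙xz (t ^ b) (t + s) _ ⟩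
    (t + s) * (t ^ b * (t + s + b * s))    ≤⟨ *-monoʳ-≤ (t + s) (bernoulli t s b) ⟩
    (t + s) * ((t + s) ^ b * (t + s))      ≡⟨ *-assoc (t + s) _ _ ⟨
    (t + s) ^ suc b * (t + s)              ∎
    where
    open ≤-Reasoning
    expand : ∀ t s b → (t + s) * (t + s + b * s) ≡ t * (t + s + suc b * s) + (s * s + b * s * s)
    expand = solve-∀
    step : t * (t + s + suc b * s) ≤ (t + s) * (t + s + b * s)
    step = subst (t * (t + s + suc b * s) ≤_) (sym (expand t s b)) (m≤m+n _ _)

  -- (1 − s/M)^b (1 + bs/M) ≤ 1, multiplied by M^(b+1).
  bernoulli-∸ : ∀ M s b → (M ∸ s) ^ b * (M + b * s) ≤ M ^ b * M
  bernoulli-∸ M s b with s ≤? M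
  ... | yes s≤M = subst (λ u → (M ∸ s) ^ b * (u + b * s) ≤ u ^ b * u) (m∸n+n≡m s≤M) (bernoulli (M ∸ s) s b)
  bernoulli-∸ M s zero    | no _ = ≤-reflexive (cong (1 *_) (+-identityʳ M))
  bernoulli-∸ M s (suc b) | no s≰M rewrite m≤n⇒m∸n≡0 (<⇒≤ (≰⇒> s≰M)) = z≤n

  balanced-split : ∀ n → 2 ≤ n → ∃₂ λ k l → k + l ≡ n × n ≤ 3 * k × n ≤ 3 * l
  balanced-split 0 ()
  balanced-split 1 (s≤s ())
  balanced-split 2 _ = 1 , 1 , refl , s≤s (s≤s z≤n) , s≤s (s≤s z≤n)
  balanced-split 3 _ = 1 , 2 , refl , ≤-refl , s≤s (s≤s (s≤s z≤n))
  balanced-split (suc (suc (suc (suc n)))) _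
    with k , l , k+l≡n , n≤3k , n≤3l ← balanced-split (2 + n) (s≤s (s≤s z≤n))
    = suc k , suc l , cong suc (trans (+-suc k l) (cong suc k+l≡n)) , grow n≤3k , grow n≤3l
    where
    grow : ∀ {j} → 2 + n ≤ 3 * j → 4 + n ≤ 3 * suc j
    grow {j} h = subst (4 + n ≤_) (sym (*-suc 3 j)) (s≤s (s≤s (m≤n⇒m≤1+n h)))

  m+n≡o+p∧n≤o⇒p≤m : ∀ m n o p → m + n ≡ o + p → n ≤ o → p ≤ m
  m+n≡o+p∧n≤o⇒p≤m m n o p eq n≤o =
    +-cancelʳ-≤ n p m (subst (p + n ≤_) (trans (+-comm p o) (sym eq)) (+-monoʳ-≤ p n≤o))

  n*[s+t]≤6*[l*s] : ∀ n l s t → n ≤ 3 * l → t ≤ s → n * (s + t) ≤ 6 * (l * s)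
  n*[s+t]≤6*[l*s] n l s t n≤3l t≤s = begin
    n * (s + t)       ≤⟨ *-mono-≤ n≤3l (+-monoʳ-≤ s t≤s) ⟩
    3 * l * (s + s)   ≡⟨ regroup l s ⟩
    6 * (l * s)       ∎
    where
    open ≤-Reasoning
    regroup : ∀ l s → 3 * l * (s + s) ≡ 6 * (l * s)
    regroup = solve-∀

module Fractions where

  open import Data.Nat using (suc; _+_; _*_; _≤_; NonZero; >-nonZero; >-nonZero⁻¹; s≤s; z≤n)
  open import Data.Nat.Properties
  open import Data.Nat.Tactic.RingSolver using (solve-∀)
  open import Algebra.Properties.CommutativeSemigroup *-commutativeSemigroup using (x∙yz≈y∙xz)
  open import Data.Integer as ℤ using (+_; +≤+)
  open import Data.Integer.Properties using (pos-*)
  open import Data.Rational using (ℚ; 1ℚ; _⊓_) renaming (_≤_ to _≤ℚ_; _*_ to _*ℚ_; _/_ to _/ℚ_)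
  import Data.Rational.Properties as ℚ
  open import Data.Rational.Unnormalised using (mkℚᵘ; *≤*)
  import Data.Rational.Unnormalised.Properties as ℚᵘ
  open import Relation.Binary.PropositionalEquality
  open import Relation.Nullary using (yes; no)

  fraction-≤ : ∀ a b c d .{{_ : NonZero b}} .{{_ : NonZero d}} →
    a * d ≤ c * b → (+ a) /ℚ b ≤ℚ (+ c) /ℚ d
  fraction-≤ a (suc b) c (suc d) h = ℚ.toℚᵘ-cancel-≤
    (ℚᵘ.≤-respʳ-≃ (ℚᵘ.≃-sym (ℚ.toℚᵘ-fromℚᵘ (mkℚᵘ (+ c) d)))
      (ℚᵘ.≤-respˡ-≃ (ℚᵘ.≃-sym (ℚ.toℚᵘ-fromℚᵘ (mkℚᵘ (+ a) b)))
        (*≤* (subst₂ ℤ._≤_ (pos-* a (suc d)) (pos-* c (suc b)) (+≤+ h)))))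

  fraction-*-≤ : ∀ a b c d e f .{{_ : NonZero b}} .{{_ : NonZero d}} .{{_ : NonZero f}} →
    a * c * f ≤ e * (b * d) → ((+ a) /ℚ b) *ℚ ((+ c) /ℚ d) ≤ℚ (+ e) /ℚ f
  fraction-*-≤ a (suc b) c (suc d) e (suc f) h = ℚ.toℚᵘ-cancel-≤
    (ℚᵘ.≤-respʳ-≃ (ℚᵘ.≃-sym (ℚ.toℚᵘ-fromℚᵘ (mkℚᵘ (+ e) f)))
      (ℚᵘ.≤-respˡ-≃ (ℚᵘ.≃-sym (ℚᵘ.≃-trans (ℚ.toℚᵘ-homo-* ((+ a) /ℚ suc b) ((+ c) /ℚ suc d))
                        (ℚᵘ.*-cong (ℚ.toℚᵘ-fromℚᵘ (mkℚᵘ (+ a) b)) (ℚ.toℚᵘ-fromℚᵘ (mkℚᵘ (+ c) d)))))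
        (*≤* (subst₂ ℤ._≤_
           (trans (pos-* (a * c) (suc f)) (cong (ℤ._* + suc f) (pos-* a c)))
           (pos-* e (suc b * suc d)) (+≤+ h)))))

  fraction-≤-1⊓ : ∀ K T N m .{{_ : NonZero T}} .{{_ : NonZero m}} → K ≤ T → K * m ≤ N * T →
    (+ K) /ℚ T ≤ℚ 1ℚ *ℚ (1ℚ ⊓ ((+ N) /ℚ m))
  fraction-≤-1⊓ K T N m K≤T Km≤NT = subst ((+ K) /ℚ T ≤ℚ_) (sym (ℚ.*-identityˡ _))
    (ℚ.⊓-glb (fraction-≤ K T 1 1 (subst₂ _≤_ (sym (*-identityʳ K)) (sym (*-identityˡ T)) K≤T))
             (fraction-≤ K T N m Km≤NT))

  1/12*1⊓-≤-fraction : ∀ K T X N m .{{_ : NonZero T}} .{{_ : NonZero m}} → T * X ≤ K * (m + X) → N ≤ 6 * X →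
    ((+ 1) /ℚ 12) *ℚ (1ℚ ⊓ ((+ N) /ℚ m)) ≤ℚ (+ K) /ℚ T
  1/12*1⊓-≤-fraction K T X N m TX≤K[m+X] N≤6X with m ≤? X
  ... | yes m≤X = ℚ.≤-trans (ℚ.*-monoˡ-≤-nonNeg ((+ 1) /ℚ 12) (ℚ.p⊓q≤p 1ℚ ((+ N) /ℚ m)))
      (subst (_≤ℚ (+ K) /ℚ T) (sym (ℚ.*-identityʳ ((+ 1) /ℚ 12))) (fraction-≤ 1 12 K T (begin
        1 * T      ≡⟨ *-identityˡ T ⟩
        T          ≤⟨ *-cancelʳ-≤ T (2 * K) X T*X≤2K*X ⟩
        2 * K      ≤⟨ *-monoˡ-≤ K {2} {12} (s≤s (s≤s z≤n)) ⟩
        12 * K     ≡⟨ *-comm 12 K ⟩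
        K * 12     ∎)))
    where
    open ≤-Reasoning
    instance
      X≢0 : NonZero X
      X≢0 = >-nonZero (<-≤-trans (>-nonZero⁻¹ m) m≤X)
    double : ∀ K X → K * (X + X) ≡ 2 * K * X
    double = solve-∀
    T*X≤2K*X : T * X ≤ 2 * K * X
    T*X≤2K*X = begin
      T * X          ≤⟨ TX≤K[m+X] ⟩
      K * (m + X)    ≤⟨ *-monoʳ-≤ K (+-monoˡ-≤ X m≤X) ⟩
      K * (X + X)    ≡⟨ double K X ⟩
      2 * K * X      ∎
  ... | no m≰X = ℚ.≤-trans (ℚ.*-monoˡ-≤-nonNeg ((+ 1) /ℚ 12) (ℚ.p⊓q≤q 1ℚ ((+ N) /ℚ m))) (fraction-*-≤ 1 12 N m K T (begin
      1 * N * T           ≡⟨ rearrange N T ⟩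
      T * N               ≤⟨ *-monoʳ-≤ T N≤6X ⟩
      T * (6 * X)         ≡⟨ x∙yz≈y∙xz T 6 X ⟩
      6 * (T * X)         ≤⟨ *-monoʳ-≤ 6 TX≤K[m+X] ⟩
      6 * (K * (m + X))   ≤⟨ *-monoʳ-≤ 6 (*-monoʳ-≤ K (+-monoʳ-≤ m (<⇒≤ (≰⇒> m≰X)))) ⟩
      6 * (K * (m + m))   ≡⟨ twelve K m ⟩
      K * (12 * m)        ∎))
    where
    open ≤-Reasoning
    rearrange : ∀ N T → 1 * N * T ≡ T * N
    rearrange = solve-∀
    twelve : ∀ K m → 6 * (K * (m + m)) ≡ K * (12 * m)
    twelve = solve-∀

module Sums where

  open import Data.List as List using (List; []; _∷_; map; concatMap; _++_; length; allFin)
  open import Data.List.Properties using (map-++; map-tabulate)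
  open import Data.List.Membership.Propositional using (_∈_)
  open import Data.List.Relation.Unary.Any using (here; there)
  open import Data.Nat using (ℕ; _+_; _*_; _≤_; z≤n)
  open import Data.Nat.ListAction using (sum)
  open import Data.Nat.ListAction.Properties using (sum-++)
  open import Data.Nat.Properties
  open import Algebra.Properties.CommutativeSemigroup +-commutativeSemigroup
    using () renaming (interchange to +-interchange)
  open import Data.Vec as Vec using (Vec; lookup) renaming ([] to []ᵥ; _∷_ to _∷ᵥ_)
  open import Function using (_∘_; id)
  open import Relation.Binary.PropositionalEquality

  private variable
    A B : Set

  ∑ : List A → (A → ℕ) → ℕ
  ∑ L f = sum (map f L)

  ∑-cong : ∀ (L : List A) {f g : A → ℕ} → (∀ {x} → x ∈ L → f x ≡ g x) → ∑ L f ≡ ∑ L g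
  ∑-cong []      eq = refl
  ∑-cong (x ∷ L) eq = cong₂ _+_ (eq (here refl)) (∑-cong L (eq ∘ there))

  ∑-mono-≤ : ∀ (L : List A) {f g : A → ℕ} → (∀ {x} → x ∈ L → f x ≤ g x) → ∑ L f ≤ ∑ L g
  ∑-mono-≤ []      le = z≤n
  ∑-mono-≤ (x ∷ L) le = +-mono-≤ (le (here refl)) (∑-mono-≤ L (le ∘ there))

  ∑-+ : ∀ (L : List A) (f g : A → ℕ) → ∑ L (λ x → f x + g x) ≡ ∑ L f + ∑ L g
  ∑-+ []      f g = refl
  ∑-+ (x ∷ L) f g = begin
    f x + g x + ∑ L (λ x → f x + g x) ≡⟨ cong (f x + g x +_) (∑-+ L f g) ⟩
    f x + g x + (∑ L f + ∑ L g)       ≡⟨ +-interchange (f x) (g x) (∑ L f) (∑ L g) ⟩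
    f x + ∑ L f + (g x + ∑ L g)       ∎
    where open ≡-Reasoning

  ∑-*ˡ : ∀ (L : List A) c (f : A → ℕ) → ∑ L (λ x → c * f x) ≡ c * ∑ L f
  ∑-*ˡ []      c f = sym (*-zeroʳ c)
  ∑-*ˡ (x ∷ L) c f = trans (cong (c * f x +_) (∑-*ˡ L c f)) (sym (*-distribˡ-+ c (f x) (∑ L f)))

  ∑-const : ∀ (L : List A) c → ∑ L (λ _ → c) ≡ length L * c
  ∑-const []      c = refl
  ∑-const (x ∷ L) c = cong (c +_) (∑-const L c)

  ∑-comm : ∀ (L₁ : List A) (L₂ : List B) (f : A → B → ℕ) →
    ∑ L₁ (λ a → ∑ L₂ (f a)) ≡ ∑ L₂ (λ b → ∑ L₁ (λ a → f a b))
  ∑-comm []       L₂ f = sym (trans (∑-const L₂ 0) (*-zeroʳ (length L₂)))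
  ∑-comm (a ∷ L₁) L₂ f =
    trans (cong (∑ L₂ (f a) +_) (∑-comm L₁ L₂ f)) (sym (∑-+ L₂ (f a) (λ b → ∑ L₁ (λ a → f a b))))

  ∑-map : ∀ (h : A → B) (L : List A) (f : B → ℕ) → ∑ (map h L) f ≡ ∑ L (f ∘ h)
  ∑-map h []      f = refl
  ∑-map h (a ∷ L) f = cong (f (h a) +_) (∑-map h L f)

  ∑-concatMap : ∀ (g : A → List B) (L : List A) (f : B → ℕ) →
    ∑ (concatMap g L) f ≡ ∑ L (λ a → ∑ (g a) f)
  ∑-concatMap g []      f = refl
  ∑-concatMap g (a ∷ L) f = begin
    sum (map f (g a ++ concatMap g L))           ≡⟨ cong sum (map-++ f (g a) (concatMap g L)) ⟩
    sum (map f (g a) ++ map f (concatMap g L))   ≡⟨ sum-++ (map f (g a)) _ ⟩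
    ∑ (g a) f + ∑ (concatMap g L) f             ≡⟨ cong (∑ (g a) f +_) (∑-concatMap g L f) ⟩
    ∑ (g a) f + ∑ L (λ a → ∑ (g a) f)           ∎
    where open ≡-Reasoning

  term≤∑ : ∀ {L : List A} (f : A → ℕ) {x} → x ∈ L → f x ≤ ∑ L f
  term≤∑ {L = y ∷ L} f (here refl) = m≤m+n (f y) _
  term≤∑ {L = y ∷ L} f (there x∈) = ≤-trans (term≤∑ f x∈) (m≤n+m _ (f y))

  sum-tabulate-lookup : ∀ {n} (D : Vec ℕ n) → sum (List.tabulate (lookup D)) ≡ Vec.sum D
  sum-tabulate-lookup []ᵥ       = refl
  sum-tabulate-lookup (d ∷ᵥ D) = cong (d +_) (sum-tabulate-lookup D)

  ∑-allFin-lookup : ∀ {n} (D : Vec ℕ n) → ∑ (allFin n) (lookup D) ≡ Vec.sum D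
  ∑-allFin-lookup {n} D = trans (cong sum (map-tabulate id (lookup D))) (sum-tabulate-lookup D)

module Indicators where

  open import Defs using (intersects)
  open Sums
  open import Data.Bool using (Bool; true; false; T; not; _∧_; _∨_)
  open import Data.Bool.ListAction using (any)
  open import Data.Empty using (⊥-elim)
  open import Data.List using (List; []; _∷_; length; upTo; filterᵇ)
  open import Data.List.Membership.Propositional using (_∈_; _∉_; find; lose)
  open import Data.List.Membership.Propositional.Properties using (∈-upTo⁺)
  open import Data.List.Relation.Unary.All as All using (All)
  open import Data.List.Relation.Unary.Any as Any using (here; there)
  open import Data.List.Relation.Unary.Any.Properties using (any⁺; any⁻)
  open import Data.List.Relation.Unary.Unique.Propositional using (Unique; _∷_)
  open import Data.List.Relation.Unary.Unique.Propositional.Properties using (upTo⁺; Unique[x∷xs]⇒x∉xs)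
  open import Data.Nat using (ℕ; suc; _+_; _*_; _≤_; _<_; _≡ᵇ_; _≟_; z≤n; s≤s)
  open import Data.Nat.Properties
  open import Data.Product using (∃; _×_; _,_)
  open import Data.Sum using (_⊎_; inj₁; inj₂)
  open import Function using (_∘_)
  open import Relation.Binary.PropositionalEquality
  open import Relation.Nullary using (¬_; yes; no)

  private variable
    A : Set

  T-not⁺ : ∀ {b} → ¬ T b → T (not b)
  T-not⁺ {false} _  = _
  T-not⁺ {true}  ¬t = ¬t _

  T-not⁻ : ∀ {b} → T (not b) → ¬ T b
  T-not⁻ {false} _ ()

  𝟙 : Bool → ℕ
  𝟙 true  = 1
  𝟙 false = 0

  𝟙-T : ∀ {b} → T b → 𝟙 b ≡ 1
  𝟙-T {true} _ = refl

  𝟙-¬T : ∀ {b} → ¬ T b → 𝟙 b ≡ 0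
  𝟙-¬T {true}  ¬t = ⊥-elim (¬t _)
  𝟙-¬T {false} _  = refl

  𝟙-mono-≤ : ∀ {a b} → (T a → T b) → 𝟙 a ≤ 𝟙 b
  𝟙-mono-≤ {false} _ = z≤n
  𝟙-mono-≤ {true}  f = ≤-reflexive (sym (𝟙-T (f _)))

  𝟙-∨-≤ : ∀ a b → 𝟙 (a ∨ b) ≤ 𝟙 a + 𝟙 b
  𝟙-∨-≤ true  b = s≤s z≤n
  𝟙-∨-≤ false b = ≤-refl

  𝟙-∨-disjoint : ∀ a b → (T a → ¬ T b) → 𝟙 (a ∨ b) ≡ 𝟙 a + 𝟙 b
  𝟙-∨-disjoint true  b disj = sym (cong suc (𝟙-¬T (disj _)))
  𝟙-∨-disjoint false b disj = refl

  𝟙-not : ∀ b → 𝟙 (not b) + 𝟙 b ≡ 1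
  𝟙-not true  = refl
  𝟙-not false = refl

  𝟙-∧ : ∀ a b → 𝟙 (a ∧ b) ≡ 𝟙 a * 𝟙 b
  𝟙-∧ true  b = sym (+-identityʳ (𝟙 b))
  𝟙-∧ false b = refl

  𝟙-≡ᵇ-sym : ∀ x y → 𝟙 (x ≡ᵇ y) ≡ 𝟙 (y ≡ᵇ x)
  𝟙-≡ᵇ-sym x y with x ≟ y
  ... | yes refl = refl
  ... | no  x≢y  = trans (𝟙-¬T (x≢y ∘ ≡ᵇ⇒≡ x y)) (sym (𝟙-¬T (x≢y ∘ sym ∘ ≡ᵇ⇒≡ y x)))

  𝟙-⊎-≤ : ∀ a b c → (T a → T b ⊎ T c) → 𝟙 a ≤ 𝟙 b + 𝟙 c
  𝟙-⊎-≤ false b c _ = z≤n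
  𝟙-⊎-≤ true  b c f with f _
  ... | inj₁ t = subst (λ u → 1 ≤ u + 𝟙 c) (sym (𝟙-T t)) (s≤s z≤n)
  ... | inj₂ t = subst (λ u → 1 ≤ 𝟙 b + u) (sym (𝟙-T t)) (m≤n+m 1 (𝟙 b))

  𝟙-any-≤ : ∀ (p : A → Bool) L → 𝟙 (any p L) ≤ ∑ L (𝟙 ∘ p)
  𝟙-any-≤ p []      = z≤n
  𝟙-any-≤ p (x ∷ L) = ≤-trans (𝟙-∨-≤ (p x) (any p L)) (+-monoʳ-≤ (𝟙 (p x)) (𝟙-any-≤ p L))

  length-filterᵇ : ∀ (p : A → Bool) L → length (filterᵇ p L) ≡ ∑ L (𝟙 ∘ p)
  length-filterᵇ p []      = refl
  length-filterᵇ p (x ∷ L) with p x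
  ... | true  = cong suc (length-filterᵇ p L)
  ... | false = length-filterᵇ p L

  memᵇ : ℕ → List ℕ → Bool
  memᵇ y L = any (y ≡ᵇ_) L

  memᵇ⁺ : ∀ {y L} → y ∈ L → T (memᵇ y L)
  memᵇ⁺ {y} y∈L = any⁺ (y ≡ᵇ_) (Any.map (≡⇒≡ᵇ y _) y∈L)

  memᵇ⁻ : ∀ {y} L → T (memᵇ y L) → y ∈ L
  memᵇ⁻ {y} L t = Any.map (≡ᵇ⇒≡ y _) (any⁻ (y ≡ᵇ_) L t)

  ∑-𝟙-≡ᵇ-∉ : ∀ {y} L → y ∉ L → ∑ L (λ x → 𝟙 (x ≡ᵇ y)) ≡ 0
  ∑-𝟙-≡ᵇ-∉ []      y∉ = refl
  ∑-𝟙-≡ᵇ-∉ (x ∷ L) y∉ =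
    cong₂ _+_ (𝟙-¬T (λ t → y∉ (here (sym (≡ᵇ⇒≡ x _ t))))) (∑-𝟙-≡ᵇ-∉ L (y∉ ∘ there))

  ∑-𝟙-≡ᵇ-≤1 : ∀ {y L} → Unique L → ∑ L (λ x → 𝟙 (x ≡ᵇ y)) ≤ 1
  ∑-𝟙-≡ᵇ-≤1 {L = []} _ = z≤n
  ∑-𝟙-≡ᵇ-≤1 {y} {x ∷ L} u@(_ ∷ uL) with x ≟ y
  ... | yes refl = ≤-reflexive (cong₂ _+_ (𝟙-T (≡⇒≡ᵇ x x refl)) (∑-𝟙-≡ᵇ-∉ L (Unique[x∷xs]⇒x∉xs u)))
  ... | no  x≢y  = subst (_≤ 1) (sym (cong (_+ _) (𝟙-¬T (x≢y ∘ ≡ᵇ⇒≡ x y)))) (∑-𝟙-≡ᵇ-≤1 uL)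

  ∑-upTo-memᵇ-≤ : ∀ k L → ∑ (upTo k) (λ x → 𝟙 (memᵇ x L)) ≤ length L
  ∑-upTo-memᵇ-≤ k L = begin
    ∑ (upTo k) (λ x → 𝟙 (memᵇ x L))              ≤⟨ ∑-mono-≤ (upTo k) (λ {x} _ → 𝟙-any-≤ (x ≡ᵇ_) L) ⟩
    ∑ (upTo k) (λ x → ∑ L (λ z → 𝟙 (x ≡ᵇ z)))    ≡⟨ ∑-comm (upTo k) L _ ⟩
    ∑ L (λ z → ∑ (upTo k) (λ x → 𝟙 (x ≡ᵇ z)))    ≤⟨ ∑-mono-≤ L (λ _ → ∑-𝟙-≡ᵇ-≤1 (upTo⁺ k)) ⟩
    ∑ L (λ _ → 1)                                ≡⟨ trans (∑-const L 1) (*-identityʳ (length L)) ⟩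
    length L                                     ∎
    where open ≤-Reasoning

  length≤∑-upTo-memᵇ : ∀ k L → Unique L → All (_< k) L → length L ≤ ∑ (upTo k) (λ x → 𝟙 (memᵇ x L))
  length≤∑-upTo-memᵇ k []      _ _ = z≤n
  length≤∑-upTo-memᵇ k (z ∷ L) u@(_ ∷ uL) (z<k All.∷ L<k) = begin
    1 + length L                                           ≤⟨ +-mono-≤ z-counted (length≤∑-upTo-memᵇ k L uL L<k) ⟩
    ∑ (upTo k) (λ x → 𝟙 (x ≡ᵇ z)) + ∑ (upTo k) (λ x → 𝟙 (memᵇ x L))
                                                           ≡⟨ ∑-+ (upTo k) _ _ ⟨
    ∑ (upTo k) (λ x → 𝟙 (x ≡ᵇ z) + 𝟙 (memᵇ x L))          ≡⟨ ∑-cong (upTo k) (λ {x} _ → 𝟙-∨-disjoint (x ≡ᵇ z) _ (z-fresh x)) ⟨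
    ∑ (upTo k) (λ x → 𝟙 ((x ≡ᵇ z) ∨ memᵇ x L))            ∎
    where
    open ≤-Reasoning
    z-counted : 1 ≤ ∑ (upTo k) (λ x → 𝟙 (x ≡ᵇ z))
    z-counted = subst (_≤ ∑ (upTo k) (λ x → 𝟙 (x ≡ᵇ z))) (𝟙-T (≡⇒≡ᵇ z z refl)) (term≤∑ (λ x → 𝟙 (x ≡ᵇ z)) (∈-upTo⁺ z<k))
    z-fresh : ∀ x → T (x ≡ᵇ z) → ¬ T (memᵇ x L)
    z-fresh x t t′ with refl ← ≡ᵇ⇒≡ x z t = Unique[x∷xs]⇒x∉xs u (memᵇ⁻ L t′)

  intersects⁺ : ∀ {l₁ l₂ z} → z ∈ l₁ → z ∈ l₂ → T (intersects l₁ l₂)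
  intersects⁺ {l₂ = l₂} z∈l₁ z∈l₂ = any⁺ (λ a → memᵇ a l₂) (lose z∈l₁ (memᵇ⁺ z∈l₂))

  intersects⁻ : ∀ l₁ l₂ → T (intersects l₁ l₂) → ∃ λ z → z ∈ l₁ × z ∈ l₂
  intersects⁻ l₁ l₂ t with z , z∈l₁ , z∈l₂ ← find (any⁻ (λ a → memᵇ a l₂) l₁ t) = z , z∈l₁ , memᵇ⁻ l₂ z∈l₂

module Arcs (m : ℕ) .{{_ : NonZero m}} where

  open import Defs using (clusterOutputs; intersects)
  open Sums
  open Indicators
  open import Data.Bool using (T)
  open import Data.List using (List; map; length; upTo)
  open import Data.List.Properties using (length-map; length-upTo; map-upTo)
  open import Data.List.Membership.Propositional using (_∈_)
  open import Data.List.Membership.Propositional.Properties using (∈-upTo⁺; ∈-upTo⁻; ∈-map⁺; ∈-map⁻)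
  open import Data.List.Relation.Unary.All as All using (All)
  open import Data.List.Relation.Unary.Unique.Propositional using (Unique)
  open import Data.List.Relation.Unary.Unique.Propositional.Properties using (applyUpTo⁺₁)
  open import Data.Nat using (ℕ; _+_; _*_; _∸_; _≤_; _<_; _≡ᵇ_; NonZero)
  open import Data.Nat.DivMod using (_%_; _/_; m≡m%n+[m/n]*n; [m+kn]%n≡m%n; m%n<n; m<n⇒m%n≡m)
  open import Data.Nat.Properties
  open import Algebra.Properties.CommutativeSemigroup +-commutativeSemigroup
    using () renaming (xy∙z≈xz∙y to +-right-comm)
  open import Data.Product using (∃; _×_; _,_)
  open import Data.Sum as Sum using (_⊎_; inj₁; inj₂)
  open import Function using (_∘_)
  open import Relation.Binary.PropositionalEquality

  %-+-cancelʳ : ∀ a c i → (a + i) % m ≡ (c + i) % m → a % m ≡ c % m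
  %-+-cancelʳ a c i eq = begin
    a % m             ≡⟨ [m+kn]%n≡m%n a p₂ m ⟨
    (a + p₂ * m) % m  ≡⟨ cong (_% m) (+-cancelʳ-≡ i _ _ shifted) ⟩
    (c + p₁ * m) % m  ≡⟨ [m+kn]%n≡m%n c p₁ m ⟩
    c % m             ∎
    where
    open ≡-Reasoning
    p₁ = (a + i) / m
    p₂ = (c + i) / m
    shifted : a + p₂ * m + i ≡ c + p₁ * m + i
    shifted = begin
      a + p₂ * m + i                          ≡⟨ +-right-comm a (p₂ * m) i ⟩
      a + i + p₂ * m                          ≡⟨ cong (_+ p₂ * m) (m≡m%n+[m/n]*n (a + i) m) ⟩
      (a + i) % m + p₁ * m + p₂ * m           ≡⟨ cong (λ r → r + p₁ * m + p₂ * m) eq ⟩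
      (c + i) % m + p₁ * m + p₂ * m           ≡⟨ +-right-comm ((c + i) % m) (p₁ * m) (p₂ * m) ⟩
      (c + i) % m + p₂ * m + p₁ * m           ≡⟨ cong (_+ p₁ * m) (m≡m%n+[m/n]*n (c + i) m) ⟨
      c + i + p₁ * m                          ≡⟨ +-right-comm c i (p₁ * m) ⟩
      c + p₁ * m + i                          ∎

  +-%-injectiveˡ : ∀ {a b} k → a < m → b < m → (a + k) % m ≡ (b + k) % m → a ≡ b
  +-%-injectiveˡ {a} {b} k a<m b<m eq =
    trans (sym (m<n⇒m%n≡m a<m)) (trans (%-+-cancelʳ a b k eq) (m<n⇒m%n≡m b<m))

  %-+-shift : ∀ {a} b i j → a < m → (a + i) % m ≡ (b + j) % m → i ≤ j → a ≡ (b + (j ∸ i)) % m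
  %-+-shift {a} b i j a<m eq i≤j = trans (sym (m<n⇒m%n≡m a<m)) (%-+-cancelʳ a (b + (j ∸ i)) i (begin
    (a + i) % m             ≡⟨ eq ⟩
    (b + j) % m             ≡⟨ cong (λ t → (b + t) % m) (m∸n+n≡m i≤j) ⟨
    (b + (j ∸ i + i)) % m   ≡⟨ cong (_% m) (+-assoc b (j ∸ i) i) ⟨
    (b + (j ∸ i) + i) % m   ∎))
    where open ≡-Reasoning

  arc : ℕ → ℕ → List ℕ
  arc = clusterOutputs m

  arc-∈⁻ : ∀ {x d z} → z ∈ arc x d → ∃ λ k → k < d × z ≡ (x + k) % m
  arc-∈⁻ {x} z∈ with k , k∈ , refl ← ∈-map⁻ (λ k → (x + k) % m) z∈ = k , ∈-upTo⁻ k∈ , refl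

  arc-∈⁺ : ∀ {x d k} → k < d → (x + k) % m ∈ arc x d
  arc-∈⁺ {x} k<d = ∈-map⁺ (λ k → (x + k) % m) (∈-upTo⁺ k<d)

  start∈arc : ∀ {x d} → x < m → 1 ≤ d → x ∈ arc x d
  start∈arc {x} {d} x<m 1≤d =
    subst (_∈ arc x d) (trans (cong (_% m) (+-identityʳ x)) (m<n⇒m%n≡m x<m)) (arc-∈⁺ 1≤d)

  arc-< : ∀ x d → All (_< m) (arc x d)
  arc-< x d = All.tabulate λ z∈ → bounded (arc-∈⁻ z∈)
    where
    bounded : ∀ {z} → ∃ (λ k → k < d × z ≡ (x + k) % m) → z < m
    bounded (k , _ , refl) = m%n<n (x + k) m

  length-arc : ∀ x d → length (arc x d) ≡ d
  length-arc x d = trans (length-map _ (upTo d)) (length-upTo d)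

  arc-unique : ∀ x d → d ≤ m → Unique (arc x d)
  arc-unique x d d≤m = subst Unique (sym (map-upTo _ d))
    (applyUpTo⁺₁ _ d λ {i} {j} i<j j<d eq → <⇒≢ i<j
      (+-%-injectiveˡ x (<-≤-trans (<-trans i<j j<d) d≤m) (<-≤-trans j<d d≤m)
        (trans (cong (_% m) (+-comm i x)) (trans eq (cong (_% m) (+-comm x j))))))

  -- If z = x + i = y + j (mod m), the start with the smaller offset lies in the other arc.
  arcs-meet : ∀ {x y d e} → x < m → y < m → T (intersects (arc x d) (arc y e)) → x ∈ arc y e ⊎ y ∈ arc x d
  arcs-meet {x} {y} {d} {e} x<m y<m meet
    with z , z∈arc-x , z∈arc-y ← intersects⁻ (arc x d) (arc y e) meet
    with i , i<d , refl ← arc-∈⁻ z∈arc-x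
    with j , j<e , z≡ ← arc-∈⁻ z∈arc-y
    with ≤-total i j
  ... | inj₁ i≤j = inj₁ (subst (_∈ arc y e) (sym (%-+-shift y i j x<m z≡ i≤j)) (arc-∈⁺ (≤-<-trans (m∸n≤m j i) j<e)))
  ... | inj₂ j≤i = inj₂ (subst (_∈ arc x d) (sym (%-+-shift x j i y<m (sym z≡) j≤i)) (arc-∈⁺ (≤-<-trans (m∸n≤m i j) i<d)))

  ∑-starts-in-arc : ∀ y e → ∑ (upTo m) (λ x → 𝟙 (memᵇ x (arc y e))) ≤ e
  ∑-starts-in-arc y e = ≤-trans (∑-upTo-memᵇ-≤ m (arc y e)) (≤-reflexive (length-arc y e))

  ∑-arcs-through : ∀ y d → ∑ (upTo m) (λ x → 𝟙 (memᵇ y (arc x d))) ≤ d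
  ∑-arcs-through y d = begin
    ∑ (upTo m) (λ x → 𝟙 (memᵇ y (arc x d)))                    ≤⟨ ∑-mono-≤ (upTo m) (λ {x} _ → 𝟙-any-≤ (y ≡ᵇ_) (arc x d)) ⟩
    ∑ (upTo m) (λ x → ∑ (arc x d) (λ z → 𝟙 (y ≡ᵇ z)))          ≡⟨ ∑-cong (upTo m) (λ {x} _ → ∑-map _ (upTo d) _) ⟩
    ∑ (upTo m) (λ x → ∑ (upTo d) (λ k → 𝟙 (y ≡ᵇ (x + k) % m))) ≡⟨ ∑-comm (upTo m) (upTo d) _ ⟩
    ∑ (upTo d) (λ k → ∑ (upTo m) (λ x → 𝟙 (y ≡ᵇ (x + k) % m))) ≤⟨ ∑-mono-≤ (upTo d) (λ {k} _ → shift-hits-once k) ⟩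
    ∑ (upTo d) (λ _ → 1)                                       ≡⟨ trans (∑-const (upTo d) 1) (trans (*-identityʳ (length (upTo d))) (length-upTo d)) ⟩
    d                                                          ∎
    where
    open ≤-Reasoning
    shift-hits-once : ∀ k → ∑ (upTo m) (λ x → 𝟙 (y ≡ᵇ (x + k) % m)) ≤ 1
    shift-hits-once k = begin
      ∑ (upTo m) (λ x → 𝟙 (y ≡ᵇ (x + k) % m)) ≡⟨ ∑-cong (upTo m) (λ {x} _ →
                                                   trans (𝟙-≡ᵇ-sym y _) (cong (λ t → 𝟙 (t % m ≡ᵇ y)) (+-comm x k))) ⟩
      ∑ (upTo m) (λ x → 𝟙 ((k + x) % m ≡ᵇ y)) ≡⟨ ∑-map _ (upTo m) _ ⟨
      ∑ (arc k m) (λ z → 𝟙 (z ≡ᵇ y))          ≤⟨ ∑-𝟙-≡ᵇ-≤1 (arc-unique k m ≤-refl) ⟩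
      1                                       ∎

  ∑-starts-meeting-arc : ∀ y d e → y < m → ∑ (upTo m) (λ x → 𝟙 (intersects (arc x d) (arc y e))) ≤ d + e
  ∑-starts-meeting-arc y d e y<m = begin
    ∑ (upTo m) (λ x → 𝟙 (intersects (arc x d) (arc y e)))
      ≤⟨ ∑-mono-≤ (upTo m) (λ {x} x∈ → 𝟙-⊎-≤ (intersects (arc x d) (arc y e)) (memᵇ x (arc y e)) (memᵇ y (arc x d))
           (Sum.map memᵇ⁺ memᵇ⁺ ∘ arcs-meet {d = d} {e} (∈-upTo⁻ x∈) y<m)) ⟩
    ∑ (upTo m) (λ x → 𝟙 (memᵇ x (arc y e)) + 𝟙 (memᵇ y (arc x d)))
      ≡⟨ ∑-+ (upTo m) _ _ ⟩
    ∑ (upTo m) (λ x → 𝟙 (memᵇ x (arc y e))) + ∑ (upTo m) (λ x → 𝟙 (memᵇ y (arc x d)))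
      ≤⟨ +-mono-≤ (∑-starts-in-arc y e) (∑-arcs-through y d) ⟩
    e + d
      ≡⟨ +-comm e d ⟩
    d + e ∎
    where open ≤-Reasoning

module Collisions (m : ℕ) .{{_ : NonZero m}} where

  open import Defs using (allStarts; collision; intersects)
  open Sums
  open Indicators
  open Arcs m
  open import Data.Bool using (T; not)
  open import Data.Bool.Properties using (T-∧)
  open import Data.Bool.ListAction using (any)
  open import Data.Fin using (Fin; toℕ) renaming (zero to fzero; suc to fsuc)
  open import Data.List using (List; map; length; upTo; allFin)
  open import Data.List.Properties using (length-upTo; length-tabulate)
  open import Data.List.Membership.Propositional using (find; lose)
  open import Data.List.Membership.Propositional.Properties using (∈-allFin; ∈-upTo⁻)
  open import Data.List.Relation.Unary.Any.Properties using (any⁺; any⁻)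
  open import Data.Nat using (ℕ; zero; suc; _+_; _*_; _^_; _≤_; _<_; z≤n; z<s; s<s; s<s⁻¹; NonZero)
  open import Data.Nat.Properties
  open import Data.Nat.Tactic.RingSolver using (solve-∀)
  open import Data.Product using (∃₂; _×_; _,_)
  open import Data.Sum using (_⊎_; inj₁; inj₂)
  open import Data.Vec as Vec using (Vec; lookup) renaming ([] to []ᵥ; _∷_ to _∷ᵥ_; _++_ to _++ᵥ_)
  open import Data.Vec.Relation.Unary.All as VecAll using () renaming (All to VecAll)
  import Data.Vec.Relation.Unary.All.Properties as VecAll
  open import Function using (_∘_; id)
  open import Function.Bundles using (Equivalence)
  open import Relation.Binary.PropositionalEquality

  ∑-starts : ∀ n → (Vec ℕ n → ℕ) → ℕ
  ∑-starts n = ∑ (allStarts m n)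

  ∑-starts-∷ : ∀ n f → ∑-starts (suc n) f ≡ ∑ (upTo m) (λ x → ∑-starts n (f ∘ (x ∷ᵥ_)))
  ∑-starts-∷ n f = trans (∑-concatMap (λ x → map (x ∷ᵥ_) (allStarts m n)) (upTo m) f)
    (∑-cong (upTo m) (λ {x} _ → ∑-map (x ∷ᵥ_) (allStarts m n) f))

  ∑-starts-mono-≤ : ∀ n {f g : Vec ℕ n → ℕ} → (∀ v → VecAll (_< m) v → f v ≤ g v) → ∑-starts n f ≤ ∑-starts n g
  ∑-starts-mono-≤ zero    le = +-monoˡ-≤ 0 (le []ᵥ VecAll.[])
  ∑-starts-mono-≤ (suc n) {f} {g} le = subst₂ _≤_ (sym (∑-starts-∷ n f)) (sym (∑-starts-∷ n g))
    (∑-mono-≤ (upTo m) λ x∈ → ∑-starts-mono-≤ n (λ v v<m → le _ (∈-upTo⁻ x∈ VecAll.∷ v<m)))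

  ∑-starts-const : ∀ n c → ∑-starts n (λ _ → c) ≡ m ^ n * c
  ∑-starts-const zero    c = refl
  ∑-starts-const (suc n) c = begin
    ∑-starts (suc n) (λ _ → c)              ≡⟨ ∑-starts-∷ n _ ⟩
    ∑ (upTo m) (λ _ → ∑-starts n (λ _ → c)) ≡⟨ ∑-cong (upTo m) (λ _ → ∑-starts-const n c) ⟩
    ∑ (upTo m) (λ _ → m ^ n * c)            ≡⟨ ∑-const (upTo m) _ ⟩
    length (upTo m) * (m ^ n * c)           ≡⟨ cong (_* (m ^ n * c)) (length-upTo m) ⟩
    m * (m ^ n * c)                         ≡⟨ *-assoc m (m ^ n) c ⟨
    m ^ suc n * c                           ∎
    where open ≡-Reasoning

  ∑-starts-++ : ∀ k l (f : Vec ℕ (k + l) → ℕ) → ∑-starts (k + l) f ≡ ∑-starts k (λ a → ∑-starts l (f ∘ (a ++ᵥ_)))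
  ∑-starts-++ zero    l f = sym (+-identityʳ _)
  ∑-starts-++ (suc k) l f = begin
    ∑-starts (suc k + l) f                                             ≡⟨ ∑-starts-∷ (k + l) f ⟩
    ∑ (upTo m) (λ x → ∑-starts (k + l) (f ∘ (x ∷ᵥ_)))                 ≡⟨ ∑-cong (upTo m) (λ {x} _ → ∑-starts-++ k l (f ∘ (x ∷ᵥ_))) ⟩
    ∑ (upTo m) (λ x → ∑-starts k (λ a → ∑-starts l (f ∘ ((x ∷ᵥ a) ++ᵥ_)))) ≡⟨ ∑-starts-∷ k _ ⟨
    ∑-starts (suc k) (λ a → ∑-starts l (f ∘ (a ++ᵥ_)))                 ∎
    where open ≡-Reasoning

  arcOf : ∀ {n} → Vec ℕ n → Vec ℕ n → Fin n → List ℕ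
  arcOf D x i = arc (lookup x i) (lookup D i)

  collision⁺ : ∀ {n} (D x : Vec ℕ n) {i j} → toℕ i < toℕ j → T (intersects (arcOf D x i) (arcOf D x j)) →
    T (collision m D x)
  collision⁺ {n} D x {i} {j} i<j meet =
    any⁺ _ (lose (∈-allFin i) (any⁺ _ (lose (∈-allFin j) (Equivalence.from T-∧ (<⇒<ᵇ i<j , meet)))))

  collision⁻ : ∀ {n} (D x : Vec ℕ n) → T (collision m D x) →
    ∃₂ λ i j → toℕ i < toℕ j × T (intersects (arcOf D x i) (arcOf D x j))
  collision⁻ {n} D x col
    with i , _ , col-i ← find (any⁻ _ (allFin n) col)
    with j , _ , col-ij ← find (any⁻ _ (allFin n) col-i)
    with i<ᵇj , meet ← Equivalence.to T-∧ col-ij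
    = i , j , <ᵇ⇒< (toℕ i) (toℕ j) i<ᵇj , meet

  collision-∷⁻ : ∀ {n} d (D : Vec ℕ n) x v → T (collision m (d ∷ᵥ D) (x ∷ᵥ v)) →
    T (collision m D v) ⊎ T (any (λ s → intersects (arc x d) (arcOf D v s)) (allFin n))
  collision-∷⁻ d D x v col with collision⁻ (d ∷ᵥ D) (x ∷ᵥ v) col
  ... | fzero  , fsuc s , _   , meet = inj₂ (any⁺ _ (lose (∈-allFin s) meet))
  ... | fsuc i , fsuc j , i<j , meet = inj₁ (collision⁺ D v (s<s⁻¹ i<j) meet)

  collision-∷⁺ : ∀ {n} d (D : Vec ℕ n) x v → T (collision m D v) → T (collision m (d ∷ᵥ D) (x ∷ᵥ v))
  collision-∷⁺ d D x v col with i , j , i<j , meet ← collision⁻ D v col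
    = collision⁺ (d ∷ᵥ D) (x ∷ᵥ v) {fsuc i} {fsuc j} (s<s i<j) meet

  collision-head⁺ : ∀ {n} d (D : Vec ℕ n) x v s → T (intersects (arc x d) (arcOf D v s)) →
    T (collision m (d ∷ᵥ D) (x ∷ᵥ v))
  collision-head⁺ d D x v s = collision⁺ (d ∷ᵥ D) (x ∷ᵥ v) {fzero} {fsuc s} z<s

  collisions : ∀ {n} → Vec ℕ n → ℕ
  collisions {n} D = ∑-starts n (𝟙 ∘ collision m D)

  noncollisions : ∀ {n} → Vec ℕ n → ℕ
  noncollisions {n} D = ∑-starts n (λ x → 𝟙 (not (collision m D x)))

  collisions+noncollisions : ∀ {n} (D : Vec ℕ n) → collisions D + noncollisions D ≡ m ^ n
  collisions+noncollisions {n} D = begin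
    collisions D + noncollisions D                                   ≡⟨ +-comm (collisions D) _ ⟩
    noncollisions D + collisions D                                   ≡⟨ ∑-+ (allStarts m n) _ _ ⟨
    ∑-starts n (λ x → 𝟙 (not (collision m D x)) + 𝟙 (collision m D x)) ≡⟨ ∑-cong (allStarts m n) (λ {x} _ → 𝟙-not (collision m D x)) ⟩
    ∑-starts n (λ _ → 1)                                             ≡⟨ ∑-starts-const n 1 ⟩
    m ^ n * 1                                                        ≡⟨ *-identityʳ (m ^ n) ⟩
    m ^ n                                                            ∎
    where open ≡-Reasoning

  𝟙-collision-∷-≤ : ∀ {n} d (D : Vec ℕ n) x v →
    𝟙 (collision m (d ∷ᵥ D) (x ∷ᵥ v)) ≤ 𝟙 (collision m D v) + ∑ (allFin n) (λ s → 𝟙 (intersects (arc x d) (arcOf D v s)))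
  𝟙-collision-∷-≤ {n} d D x v = ≤-trans (𝟙-⊎-≤ _ _ _ (collision-∷⁻ d D x v)) (+-monoʳ-≤ _ (𝟙-any-≤ _ (allFin n)))

  ∑-starts-meeting-arcs : ∀ {n} d (D v : Vec ℕ n) → VecAll (_< m) v →
    ∑ (upTo m) (λ x → ∑ (allFin n) (λ s → 𝟙 (intersects (arc x d) (arcOf D v s)))) ≤ n * d + Vec.sum D
  ∑-starts-meeting-arcs {n} d D v v<m = begin
    ∑ (upTo m) (λ x → ∑ (allFin n) (λ s → 𝟙 (intersects (arc x d) (arcOf D v s))))
      ≡⟨ ∑-comm (upTo m) (allFin n) _ ⟩
    ∑ (allFin n) (λ s → ∑ (upTo m) (λ x → 𝟙 (intersects (arc x d) (arcOf D v s))))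
      ≤⟨ ∑-mono-≤ (allFin n) (λ {s} _ → ∑-starts-meeting-arc (lookup v s) d (lookup D s) (VecAll.lookup⁺ v<m s)) ⟩
    ∑ (allFin n) (λ s → d + lookup D s)
      ≡⟨ ∑-+ (allFin n) (λ _ → d) (lookup D) ⟩
    ∑ (allFin n) (λ _ → d) + ∑ (allFin n) (lookup D)
      ≡⟨ cong₂ _+_ (trans (∑-const (allFin n) d) (cong (_* d) (length-tabulate {n = n} id))) (∑-allFin-lookup D) ⟩
    n * d + Vec.sum D ∎
    where open ≤-Reasoning

  collisions-∷-≤ : ∀ {n} d (D : Vec ℕ n) → collisions (d ∷ᵥ D) ≤ m * collisions D + m ^ n * (n * d + Vec.sum D)
  collisions-∷-≤ {n} d D = begin
    collisions (d ∷ᵥ D)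
      ≡⟨ ∑-starts-∷ n _ ⟩
    ∑ (upTo m) (λ x → ∑-starts n (λ v → 𝟙 (collision m (d ∷ᵥ D) (x ∷ᵥ v))))
      ≤⟨ ∑-mono-≤ (upTo m) (λ {x} _ → ∑-starts-mono-≤ n (λ v _ → 𝟙-collision-∷-≤ d D x v)) ⟩
    ∑ (upTo m) (λ x → ∑-starts n (λ v → 𝟙 (collision m D v) + meeting x v))
      ≡⟨ ∑-cong (upTo m) (λ _ → ∑-+ (allStarts m n) _ _) ⟩
    ∑ (upTo m) (λ x → collisions D + ∑-starts n (meeting x))
      ≡⟨ ∑-+ (upTo m) _ _ ⟩
    ∑ (upTo m) (λ _ → collisions D) + ∑ (upTo m) (λ x → ∑-starts n (meeting x))
      ≡⟨ cong₂ _+_ (trans (∑-const (upTo m) _) (cong (_* collisions D) (length-upTo m))) (∑-comm (upTo m) (allStarts m n) meeting) ⟩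
    m * collisions D + ∑-starts n (λ v → ∑ (upTo m) (λ x → meeting x v))
      ≤⟨ +-monoʳ-≤ _ (∑-starts-mono-≤ n (λ v v<m → ∑-starts-meeting-arcs d D v v<m)) ⟩
    m * collisions D + ∑-starts n (λ _ → n * d + Vec.sum D)
      ≡⟨ cong (m * collisions D +_) (∑-starts-const n _) ⟩
    m * collisions D + m ^ n * (n * d + Vec.sum D) ∎
    where
    open ≤-Reasoning
    meeting : ℕ → Vec ℕ n → ℕ
    meeting x v = ∑ (allFin n) (λ s → 𝟙 (intersects (arc x d) (arcOf D v s)))

  collisions-≤ : ∀ {n} (D : Vec ℕ n) → collisions D * m ≤ m ^ n * (n * Vec.sum D)
  collisions-≤ []ᵥ = z≤n
  collisions-≤ {suc n} (d ∷ᵥ D) = begin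
    collisions (d ∷ᵥ D) * m                                        ≤⟨ *-monoˡ-≤ m (collisions-∷-≤ d D) ⟩
    (m * collisions D + m ^ n * (n * d + S)) * m                   ≡⟨ expand m (collisions D) (m ^ n) (n * d + S) ⟩
    m * (collisions D * m) + m * m ^ n * (n * d + S)               ≤⟨ +-monoˡ-≤ _ (*-monoʳ-≤ m (collisions-≤ D)) ⟩
    m * (m ^ n * (n * S)) + m * m ^ n * (n * d + S)                ≡⟨ collect m (m ^ n) n d S ⟩
    m * m ^ n * (n * S + n * d + S)                                ≤⟨ *-monoʳ-≤ (m * m ^ n) (m≤n+m _ d) ⟩
    m * m ^ n * (d + (n * S + n * d + S))                          ≡⟨ cong (m * m ^ n *_) (regroup n d S) ⟩
    m * m ^ n * (suc n * (d + S))                                  ∎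
    where
    open ≤-Reasoning
    S = Vec.sum D
    expand : ∀ m C P X → (m * C + P * X) * m ≡ m * (C * m) + m * P * X
    expand = solve-∀
    collect : ∀ m P n d S → m * (P * (n * S)) + m * P * (n * d + S) ≡ m * P * (n * S + n * d + S)
    collect = solve-∀
    regroup : ∀ n d S → d + (n * S + n * d + S) ≡ suc n * (d + S)
    regroup = solve-∀

module LowerBound (m : ℕ) .{{_ : NonZero m}} where

  open import Defs using (allStarts; collision; intersects)
  open Arithmetic
  open Sums
  open Indicators
  open Arcs m
  open Collisions m
  open import Data.Bool using (Bool; true; T; not; _∧_)
  open import Data.Bool.Properties using (T-∧)
  open import Data.Fin using (_↑ˡ_; _↑ʳ_) renaming (zero to fzero; suc to fsuc)
  open import Data.Fin.Properties using (toℕ-↑ˡ; toℕ-↑ʳ; toℕ<n)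
  open import Data.List using (List; []; _++_; length; upTo)
  open import Data.List.Properties using (length-++; length-upTo)
  open import Data.List.Membership.Propositional using (_∈_)
  open import Data.List.Membership.Propositional.Properties using (∈-++⁻)
  open import Data.List.Relation.Unary.All as All using (All)
  import Data.List.Relation.Unary.All.Properties as All
  import Data.List.Relation.Unary.AllPairs as AllPairs
  open import Data.List.Relation.Unary.Unique.Propositional using (Unique)
  import Data.List.Relation.Unary.Unique.Propositional.Properties as Unique
  open import Data.Nat using (ℕ; zero; suc; _+_; _*_; _∸_; _^_; _≤_; _<_; z≤n; NonZero)
  open import Data.Nat.Properties
  open import Data.Product using (∃; _×_; _,_; proj₁; proj₂)
  open import Data.Sum using (inj₁; inj₂)
  open import Data.Vec as Vec using (Vec; lookup) renaming ([] to []ᵥ; _∷_ to _∷ᵥ_; _++_ to _++ᵥ_)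
  open import Data.Vec.Properties using (lookup-++ˡ; lookup-++ʳ; sum-++)
  open import Data.Vec.Relation.Unary.All as VecAll using () renaming (All to VecAll)
  import Data.Vec.Relation.Unary.All.Properties as VecAll
  open import Function using (_∘_)
  open import Function.Bundles using (Equivalence)
  open import Relation.Binary.PropositionalEquality
  open import Relation.Nullary using (¬_; yes; no)
  open import Relation.Nullary.Decidable using (T?)

  covered : ∀ {k} → Vec ℕ k → Vec ℕ k → List ℕ
  covered []ᵥ       []ᵥ       = []
  covered (d ∷ᵥ D) (x ∷ᵥ v) = arc x d ++ covered D v

  covered-∈⁻ : ∀ {k} (D v : Vec ℕ k) {z} → z ∈ covered D v → ∃ λ i → z ∈ arcOf D v i
  covered-∈⁻ []ᵥ       []ᵥ       ()
  covered-∈⁻ (d ∷ᵥ D) (x ∷ᵥ v) z∈ with ∈-++⁻ (arc x d) z∈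
  ... | inj₁ z∈arc = fzero , z∈arc
  ... | inj₂ z∈rest with i , z∈arc ← covered-∈⁻ D v z∈rest = fsuc i , z∈arc

  length-covered : ∀ {k} (D v : Vec ℕ k) → length (covered D v) ≡ Vec.sum D
  length-covered []ᵥ       []ᵥ       = refl
  length-covered (d ∷ᵥ D) (x ∷ᵥ v) = trans (length-++ (arc x d)) (cong₂ _+_ (length-arc x d) (length-covered D v))

  covered-< : ∀ {k} (D v : Vec ℕ k) → All (_< m) (covered D v)
  covered-< []ᵥ       []ᵥ       = All.[]
  covered-< (d ∷ᵥ D) (x ∷ᵥ v) = All.++⁺ (arc-< x d) (covered-< D v)

  covered-unique : ∀ {k} (D v : Vec ℕ k) → VecAll (_≤ m) D → ¬ T (collision m D v) → Unique (covered D v)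
  covered-unique []ᵥ       []ᵥ       _ _ = AllPairs.[]
  covered-unique (d ∷ᵥ D) (x ∷ᵥ v) (d≤m VecAll.∷ D≤m) no-col =
    Unique.++⁺ (arc-unique x d d≤m) (covered-unique D v D≤m (no-col ∘ collision-∷⁺ d D x v)) disjoint
    where
    disjoint : ∀ {z} → ¬ (z ∈ arc x d × z ∈ covered D v)
    disjoint (z∈arc , z∈rest) with s , z∈arcₛ ← covered-∈⁻ D v z∈rest =
      no-col (collision-head⁺ d D x v s (intersects⁺ z∈arc z∈arcₛ))

  avoids : List ℕ → ∀ {l} → Vec ℕ l → Bool
  avoids L []ᵥ       = true
  avoids L (y ∷ᵥ b) = not (memᵇ y L) ∧ avoids L b

  avoids⁺ : ∀ L {l} (b : Vec ℕ l) → (∀ j → ¬ T (memᵇ (lookup b j) L)) → T (avoids L b)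
  avoids⁺ L []ᵥ       _      = _
  avoids⁺ L (y ∷ᵥ b) y∉L = Equivalence.from T-∧ (T-not⁺ (y∉L fzero) , avoids⁺ L b (y∉L ∘ fsuc))

  outside : List ℕ → ℕ
  outside L = ∑ (upTo m) (λ y → 𝟙 (not (memᵇ y L)))

  ∑-starts-avoids : ∀ L l → ∑-starts l (𝟙 ∘ avoids L) ≡ outside L ^ l
  ∑-starts-avoids L zero    = refl
  ∑-starts-avoids L (suc l) = begin
    ∑-starts (suc l) (𝟙 ∘ avoids L)
      ≡⟨ ∑-starts-∷ l _ ⟩
    ∑ (upTo m) (λ y → ∑-starts l (λ b → 𝟙 (not (memᵇ y L) ∧ avoids L b)))
      ≡⟨ ∑-cong (upTo m) (λ {y} _ → ∑-cong (allStarts m l) (λ {b} _ → 𝟙-∧ (not (memᵇ y L)) (avoids L b))) ⟩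
    ∑ (upTo m) (λ y → ∑-starts l (λ b → 𝟙 (not (memᵇ y L)) * 𝟙 (avoids L b)))
      ≡⟨ ∑-cong (upTo m) (λ {y} _ → ∑-*ˡ (allStarts m l) (𝟙 (not (memᵇ y L))) (𝟙 ∘ avoids L)) ⟩
    ∑ (upTo m) (λ y → 𝟙 (not (memᵇ y L)) * ∑-starts l (𝟙 ∘ avoids L))
      ≡⟨ ∑-cong (upTo m) (λ {y} _ → trans (cong (𝟙 (not (memᵇ y L)) *_) (∑-starts-avoids L l)) (*-comm (𝟙 (not (memᵇ y L))) _)) ⟩
    ∑ (upTo m) (λ y → outside L ^ l * 𝟙 (not (memᵇ y L)))
      ≡⟨ ∑-*ˡ (upTo m) (outside L ^ l) _ ⟩
    outside L ^ l * outside L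
      ≡⟨ *-comm (outside L ^ l) (outside L) ⟩
    outside L ^ suc l ∎
    where open ≡-Reasoning

  outside-≤ : ∀ L → Unique L → All (_< m) L → outside L ≤ m ∸ length L
  outside-≤ L unique L<m = begin
    outside L                      ≡⟨ m+n∸n≡m (outside L) inside ⟨
    outside L + inside ∸ inside    ≡⟨ cong (_∸ inside) partition ⟩
    m ∸ inside                     ≤⟨ ∸-monoʳ-≤ m (length≤∑-upTo-memᵇ m L unique L<m) ⟩
    m ∸ length L                   ∎
    where
    open ≤-Reasoning
    inside = ∑ (upTo m) (λ y → 𝟙 (memᵇ y L))
    partition : outside L + inside ≡ m
    partition = begin-equality
      outside L + inside                                   ≡⟨ ∑-+ (upTo m) _ _ ⟨
      ∑ (upTo m) (λ y → 𝟙 (not (memᵇ y L)) + 𝟙 (memᵇ y L)) ≡⟨ ∑-cong (upTo m) (λ {y} _ → 𝟙-not (memᵇ y L)) ⟩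
      ∑ (upTo m) (λ _ → 1)                                 ≡⟨ ∑-const (upTo m) 1 ⟩
      length (upTo m) * 1                                  ≡⟨ *-identityʳ _ ⟩
      length (upTo m)                                      ≡⟨ length-upTo m ⟩
      m                                                    ∎

  ∑-starts-avoiders-≤ : ∀ {k} (D W : Vec ℕ k) → VecAll (_≤ m) D → ∀ l (P : Vec ℕ l → Bool) →
    (T (collision m D W) → ∀ b → ¬ T (P b)) →
    (∀ b → VecAll (_< m) b → T (P b) → T (avoids (covered D W) b)) →
    ∑-starts l (𝟙 ∘ P) ≤ (m ∸ Vec.sum D) ^ l
  ∑-starts-avoiders-≤ D W D≤m l P excluded avoiding with T? (collision m D W)
  ... | yes col = begin
    ∑-starts l (𝟙 ∘ P)      ≡⟨ ∑-cong (allStarts m l) (λ {b} _ → 𝟙-¬T (excluded col b)) ⟩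
    ∑-starts l (λ _ → 0)    ≡⟨ trans (∑-starts-const l 0) (*-zeroʳ (m ^ l)) ⟩
    0                       ≤⟨ z≤n ⟩
    (m ∸ Vec.sum D) ^ l     ∎
    where open ≤-Reasoning
  ... | no no-col = begin
    ∑-starts l (𝟙 ∘ P)                           ≤⟨ ∑-starts-mono-≤ l (λ b b<m → 𝟙-mono-≤ (avoiding b b<m)) ⟩
    ∑-starts l (𝟙 ∘ avoids (covered D W))        ≡⟨ ∑-starts-avoids (covered D W) l ⟩
    outside (covered D W) ^ l                    ≤⟨ ^-monoˡ-≤ l (outside-≤ _ (covered-unique D W D≤m no-col) (covered-< D W)) ⟩
    (m ∸ length (covered D W)) ^ l               ≡⟨ cong (λ t → (m ∸ t) ^ l) (length-covered D W) ⟩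
    (m ∸ Vec.sum D) ^ l                          ∎
    where open ≤-Reasoning

  module _ {k l} (D₁ : Vec ℕ k) (D₂ : Vec ℕ l) (a : Vec ℕ k) (b : Vec ℕ l) where

    private
      D = D₁ ++ᵥ D₂
      x = a ++ᵥ b

    arcOf-↑ˡ : ∀ i → arcOf D x (i ↑ˡ l) ≡ arcOf D₁ a i
    arcOf-↑ˡ i = cong₂ arc (lookup-++ˡ a b i) (lookup-++ˡ D₁ D₂ i)

    arcOf-↑ʳ : ∀ j → arcOf D x (k ↑ʳ j) ≡ arcOf D₂ b j
    arcOf-↑ʳ j = cong₂ arc (lookup-++ʳ a b j) (lookup-++ʳ D₁ D₂ j)

    collision-++ˡ : T (collision m D₁ a) → T (collision m D x)
    collision-++ˡ col with i , j , i<j , meet ← collision⁻ D₁ a col =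
      collision⁺ D x {i ↑ˡ l} {j ↑ˡ l}
        (subst₂ _<_ (sym (toℕ-↑ˡ i l)) (sym (toℕ-↑ˡ j l)) i<j)
        (subst₂ (λ u v → T (intersects u v)) (sym (arcOf-↑ˡ i)) (sym (arcOf-↑ˡ j)) meet)

    collision-++ʳ : T (collision m D₂ b) → T (collision m D x)
    collision-++ʳ col with i , j , i<j , meet ← collision⁻ D₂ b col =
      collision⁺ D x {k ↑ʳ i} {k ↑ʳ j}
        (subst₂ _<_ (sym (toℕ-↑ʳ k i)) (sym (toℕ-↑ʳ k j)) (+-monoʳ-< k i<j))
        (subst₂ (λ u v → T (intersects u v)) (sym (arcOf-↑ʳ i)) (sym (arcOf-↑ʳ j)) meet)

    collision-++ : ∀ i j → T (intersects (arcOf D₁ a i) (arcOf D₂ b j)) → T (collision m D x)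
    collision-++ i j meet =
      collision⁺ D x {i ↑ˡ l} {k ↑ʳ j}
        (subst₂ _<_ (sym (toℕ-↑ˡ i l)) (sym (toℕ-↑ʳ k j)) (<-≤-trans (toℕ<n i) (m≤m+n k _)))
        (subst₂ (λ u v → T (intersects u v)) (sym (arcOf-↑ˡ i)) (sym (arcOf-↑ʳ j)) meet)

    no-collision⇒avoidsˡ : VecAll (1 ≤_) D₂ → VecAll (_< m) b → ¬ T (collision m D x) → T (avoids (covered D₁ a) b)
    no-collision⇒avoidsˡ D₂≥1 b<m no-col = avoids⁺ _ b λ j bⱼ∈cov →
      let i , bⱼ∈ = covered-∈⁻ D₁ a (memᵇ⁻ _ bⱼ∈cov) in
      no-col (collision-++ i j (intersects⁺ bⱼ∈ (start∈arc (VecAll.lookup⁺ b<m j) (VecAll.lookup⁺ D₂≥1 j))))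

    no-collision⇒avoidsʳ : VecAll (1 ≤_) D₁ → VecAll (_< m) a → ¬ T (collision m D x) → T (avoids (covered D₂ b) a)
    no-collision⇒avoidsʳ D₁≥1 a<m no-col = avoids⁺ _ a λ i aᵢ∈cov →
      let j , aᵢ∈ = covered-∈⁻ D₂ b (memᵇ⁻ _ aᵢ∈cov) in
      no-col (collision-++ i j (intersects⁺ (start∈arc (VecAll.lookup⁺ a<m i) (VecAll.lookup⁺ D₁≥1 i)) aᵢ∈))

  module _ {k l} (D₁ : Vec ℕ k) (D₂ : Vec ℕ l) where

    noncollisions-++-≤ˡ : VecAll (_≤ m) D₁ → VecAll (1 ≤_) D₂ → noncollisions (D₁ ++ᵥ D₂) ≤ m ^ k * (m ∸ Vec.sum D₁) ^ l
    noncollisions-++-≤ˡ D₁≤m D₂≥1 = begin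
      noncollisions (D₁ ++ᵥ D₂)                                              ≡⟨ ∑-starts-++ k l _ ⟩
      ∑-starts k (λ a → ∑-starts l (λ b → 𝟙 (not (collision m (D₁ ++ᵥ D₂) (a ++ᵥ b))))) ≤⟨ ∑-starts-mono-≤ k per-a ⟩
      ∑-starts k (λ _ → (m ∸ Vec.sum D₁) ^ l)                                ≡⟨ ∑-starts-const k _ ⟩
      m ^ k * (m ∸ Vec.sum D₁) ^ l                                           ∎
      where
      open ≤-Reasoning
      per-a : ∀ a → VecAll (_< m) a → ∑-starts l (λ b → 𝟙 (not (collision m (D₁ ++ᵥ D₂) (a ++ᵥ b)))) ≤ (m ∸ Vec.sum D₁) ^ l
      per-a a _ = ∑-starts-avoiders-≤ D₁ a D₁≤m l _
        (λ col b nc → T-not⁻ nc (collision-++ˡ D₁ D₂ a b col))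
        (λ b b<m → no-collision⇒avoidsˡ D₁ D₂ a b D₂≥1 b<m ∘ T-not⁻)

    noncollisions-++-≤ʳ : VecAll (1 ≤_) D₁ → VecAll (_≤ m) D₂ → noncollisions (D₁ ++ᵥ D₂) ≤ m ^ l * (m ∸ Vec.sum D₂) ^ k
    noncollisions-++-≤ʳ D₁≥1 D₂≤m = begin
      noncollisions (D₁ ++ᵥ D₂)                                              ≡⟨ ∑-starts-++ k l _ ⟩
      ∑-starts k (λ a → ∑-starts l (λ b → 𝟙 (not (collision m (D₁ ++ᵥ D₂) (a ++ᵥ b))))) ≡⟨ ∑-comm (allStarts m k) (allStarts m l) _ ⟩
      ∑-starts l (λ b → ∑-starts k (λ a → 𝟙 (not (collision m (D₁ ++ᵥ D₂) (a ++ᵥ b))))) ≤⟨ ∑-starts-mono-≤ l per-b ⟩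
      ∑-starts l (λ _ → (m ∸ Vec.sum D₂) ^ k)                                ≡⟨ ∑-starts-const l _ ⟩
      m ^ l * (m ∸ Vec.sum D₂) ^ k                                           ∎
      where
      open ≤-Reasoning
      per-b : ∀ b → VecAll (_< m) b → ∑-starts k (λ a → 𝟙 (not (collision m (D₁ ++ᵥ D₂) (a ++ᵥ b)))) ≤ (m ∸ Vec.sum D₂) ^ k
      per-b b _ = ∑-starts-avoiders-≤ D₂ b D₂≤m k _
        (λ col a nc → T-not⁻ nc (collision-++ʳ D₁ D₂ a b col))
        (λ a a<m → no-collision⇒avoidsʳ D₁ D₂ a b D₁≥1 a<m ∘ T-not⁻)

  collisions-≥ : ∀ {n} (D : Vec ℕ n) p q s → p + q ≡ n → noncollisions D ≤ m ^ p * (m ∸ s) ^ q →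
    m ^ n * (q * s) ≤ collisions D * (m + q * s)
  collisions-≥ {n} D p q s p+q≡n few =
    m+n≡o+p∧n≤o⇒p≤m (collisions D * (m + X)) (noncollisions D * (m + X)) (m ^ n * m) (m ^ n * X) total bounded
    where
    open ≤-Reasoning
    X = q * s
    total : collisions D * (m + X) + noncollisions D * (m + X) ≡ m ^ n * m + m ^ n * X
    total = begin-equality
      collisions D * (m + X) + noncollisions D * (m + X) ≡⟨ *-distribʳ-+ (m + X) (collisions D) _ ⟨
      (collisions D + noncollisions D) * (m + X)         ≡⟨ cong (_* (m + X)) (collisions+noncollisions D) ⟩
      m ^ n * (m + X)                                    ≡⟨ *-distribˡ-+ (m ^ n) m X ⟩
      m ^ n * m + m ^ n * X                              ∎
    bounded : noncollisions D * (m + X) ≤ m ^ n * m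
    bounded = begin
      noncollisions D * (m + X)           ≤⟨ *-monoˡ-≤ (m + X) few ⟩
      m ^ p * (m ∸ s) ^ q * (m + X)       ≡⟨ *-assoc (m ^ p) _ _ ⟩
      m ^ p * ((m ∸ s) ^ q * (m + X))     ≤⟨ *-monoʳ-≤ (m ^ p) (bernoulli-∸ m s q) ⟩
      m ^ p * (m ^ q * m)                 ≡⟨ *-assoc (m ^ p) _ _ ⟨
      m ^ p * m ^ q * m                   ≡⟨ cong (_* m) (^-distribˡ-+-* m p q) ⟨
      m ^ (p + q) * m                     ≡⟨ cong (λ t → m ^ t * m) p+q≡n ⟩
      m ^ n * m                           ∎

  collisions-++-≥ : ∀ {k l} (D₁ : Vec ℕ k) (D₂ : Vec ℕ l) → VecAll (λ d → 1 ≤ d × d ≤ m) (D₁ ++ᵥ D₂) →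
    k + l ≤ 3 * k → k + l ≤ 3 * l →
    ∃ λ X → m ^ (k + l) * X ≤ collisions (D₁ ++ᵥ D₂) * (m + X) × (k + l) * Vec.sum (D₁ ++ᵥ D₂) ≤ 6 * X
  collisions-++-≥ {k} {l} D₁ D₂ bounds n≤3k n≤3l
    with bounds₁ , bounds₂ ← VecAll.++⁻ D₁ bounds
    with Vec.sum D₂ ≤? Vec.sum D₁
  ... | yes S₂≤S₁ =
    l * S₁ ,
    collisions-≥ D k l S₁ refl (noncollisions-++-≤ˡ D₁ D₂ (VecAll.map proj₂ bounds₁) (VecAll.map proj₁ bounds₂)) ,
    subst (λ t → (k + l) * t ≤ 6 * (l * S₁)) (sym (sum-++ D₁)) (n*[s+t]≤6*[l*s] (k + l) l S₁ S₂ n≤3l S₂≤S₁)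
    where
    D = D₁ ++ᵥ D₂
    S₁ = Vec.sum D₁
    S₂ = Vec.sum D₂
  ... | no S₂≰S₁ =
    k * S₂ ,
    collisions-≥ D l k S₂ (+-comm l k) (noncollisions-++-≤ʳ D₁ D₂ (VecAll.map proj₁ bounds₁) (VecAll.map proj₂ bounds₂)) ,
    subst (λ t → (k + l) * t ≤ 6 * (k * S₂)) (sym (trans (sum-++ D₁) (+-comm S₁ S₂)))
      (n*[s+t]≤6*[l*s] (k + l) k S₂ S₁ n≤3k (<⇒≤ (≰⇒> S₂≰S₁)))
    where
    D = D₁ ++ᵥ D₂
    S₁ = Vec.sum D₁
    S₂ = Vec.sum D₂

  collisions-lower-bound : ∀ {n} → 2 ≤ n → (D : Vec ℕ n) → VecAll (λ d → 1 ≤ d × d ≤ m) D →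
    ∃ λ X → m ^ n * X ≤ collisions D * (m + X) × n * Vec.sum D ≤ 6 * X
  collisions-lower-bound {n} n≥2 D bounds with balanced-split n n≥2
  ... | k , l , refl , n≤3k , n≤3l with D₁ , D₂ , refl ← Vec.splitAt k D =
    collisions-++-≥ D₁ D₂ bounds n≤3k n≤3l

module Bounds (m : ℕ) .{{_ : NonZero m}} {n : ℕ} (D : Vec ℕ n) where

  open import Defs using (allStarts; collision; collisionCount; pCluster; clusterBound)
  open Fractions
  open Indicators
  open Collisions m
  open LowerBound m
  open import Data.Integer using (+_)
  open import Data.Nat using (_+_; _*_; _^_)
  open import Data.Nat.Properties using (m^n≢0; m≤m+n; *-comm)
  open import Data.Product using (_×_; _,_)
  open import Data.Rational using (1ℚ) renaming (_≤_ to _≤ℚ_; _*_ to _*ℚ_; _/_ to _/ℚ_)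
  open import Data.Vec as Vec using ()
  open import Data.Vec.Relation.Unary.All using (All)
  open import Relation.Binary.PropositionalEquality

  instance
    mⁿ≢0 : NonZero (m ^ n)
    mⁿ≢0 = m^n≢0 m n

  collisionCount≡collisions : collisionCount m D ≡ collisions D
  collisionCount≡collisions = length-filterᵇ (collision m D) (allStarts m n)

  pCluster-≤ : pCluster m D ≤ℚ 1ℚ *ℚ clusterBound m D
  pCluster-≤ = fraction-≤-1⊓ (collisionCount m D) (m ^ n) (n * Vec.sum D) m
    (subst₂ _≤_ (sym collisionCount≡collisions) (collisions+noncollisions D) (m≤m+n _ _))
    (subst (_≤ n * Vec.sum D * m ^ n) (sym (cong (_* m) collisionCount≡collisions))
      (subst (collisions D * m ≤_) (*-comm (m ^ n) _) (collisions-≤ D)))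

  pCluster-≥ : 2 ≤ n → All (λ d → 1 ≤ d × d ≤ m) D → ((+ 1) /ℚ 12) *ℚ clusterBound m D ≤ℚ pCluster m D
  pCluster-≥ n≥2 bounds with X , mⁿX≤ , nS≤6X ← collisions-lower-bound n≥2 D bounds =
    1/12*1⊓-≤-fraction (collisionCount m D) (m ^ n) X (n * Vec.sum D) m
      (subst (λ K → m ^ n * X ≤ K * (m + X)) (sym collisionCount≡collisions) mⁿX≤) nS≤6X

open import Defs
open import Data.Vec.Relation.Unary.All using (All)
open import Data.Product using (∃; _×_; _,_)
open import Data.Rational using (ℚ; Positive; _*_; _/_; 1ℚ) renaming (_≤_ to _≤ℚ_)
open import Data.Integer using (+_)

theorem3p1 : ∃ λ (c : ℚ) → ∃ λ (C : ℚ) → Positive c × Positive C ×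
    (∀ (m n : ℕ) .{{_ : NonZero m}} → 2 ≤ n → (D : Vec ℕ n) →
      All (λ d → 1 ≤ d × d ≤ m) D →
      (c * clusterBound m D ≤ℚ pCluster m D) × (pCluster m D ≤ℚ C * clusterBound m D))
theorem3p1 = (+ 1) / 12 , 1ℚ , _ , _ , λ m n n≥2 D bounds →
  Bounds.pCluster-≥ m D n≥2 bounds , Bounds.pCluster-≤ m D
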